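{- For every nonnegative integer $n$, the triangular grid $T_n$ satisfies $\iota(T_n)\ge \frac25 |V(T_n)|$.
   Context: For a finite simple graph $G$, a set $S\subseteq V(G)$ is an indeque set if the induced subgraph $G[S]$ is a disjoint union of cliques with no edges between distinct cliques. The indeque number $\iota(G)$ is the maximum size of an indeque set of $G$. The triangular grid $T_n$ has vertex set $V_n=\{(i,j)\in\mathbb{Z}_{\ge 0}^2: i+j\le n\}$, and $(i,j)\sim(i',j')$ if and only if either $j=j'$ and $|i-i'|=1$, or $i=i'$ and $|j-j'|=1$, or $i-i'=j'-j=\pm1$. (So $T_0$ is a single vertex, $T_1=K_3$, and $T_2$ has $6$ vertices and $9$ edges.) -}

module Defs where

open import Data.Nat using (ℕ; zero; suc; _+_; _*_; _≤_)
open import Data.Product using (_×_; _,_)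
open import Data.Sum using (_⊎_)
open import Data.List using (List; []; _∷_; _++_; map; length; concatMap; upTo)
open import Data.List.Membership.Propositional using (_∈_)
open import Data.List.Relation.Unary.All using (All)
open import Data.List.Relation.Unary.Unique.Propositional using (Unique)
open import Relation.Binary.PropositionalEquality using (_≡_)
open import Relation.Nullary using (¬_)

Vertex : Set
Vertex = ℕ × ℕ

InGrid : ℕ → Vertex → Set
InGrid n (i , j) = i + j ≤ n

data Adj : Vertex → Vertex → Set where
  right : ∀ i j → Adj (i , j) (suc i , j)
  left  : ∀ i j → Adj (suc i , j) (i , j)
  up    : ∀ i j → Adj (i , j) (i , suc j)
  down  : ∀ i j → Adj (i , suc j) (i , j)
  diag₁ : ∀ i j → Adj (suc i , j) (i , suc j)
  diag₂ : ∀ i j → Adj (i , suc j) (suc i , j)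

vertices : ℕ → List Vertex
vertices n = concatMap (λ i → map (λ j → (i , j)) (upTo (suc n Data.Nat.∸ i))) (upTo (suc n))

-- S ⊆ V(T_n) is an indeque set: G[S] is a disjoint union of cliques with
-- no edges between distinct cliques, i.e. adjacency inside S is
-- transitive on distinct vertices (every component of G[S] is a clique).
IsIndeque : ℕ → List Vertex → Set
IsIndeque n S =
  Unique S × All (InGrid n) S ×
  (∀ {x y z} → x ∈ S → y ∈ S → z ∈ S →
     Adj x y → Adj y z → ¬ (x ≡ z) → Adj x z)

-- Colour the vertex (i , j) by i + 3j mod 5 and keep the vertices of colour 0 or 1.
-- A vertical edge changes the colour by 3 and an anti-diagonal edge by 2, so kept
-- vertices can only be horizontally adjacent, and no three consecutive vertices of a
-- row are kept: the kept vertices induce a matching plus isolated vertices, which is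
-- an indeque set.  Going up a column adds 3 to the colour, so any 5 consecutive
-- vertices of a column contain exactly 2 kept ones.  The grid with 5 + m columns (of
-- heights 5 + m, …, 1) is the grid with m columns, each lengthened by 5, followed by
-- five columns of heights 5, …, 1 that hold 6 kept vertices whatever their colours.
-- So passing from m to 5 + m columns adds 5m + 15 vertices and 2m + 6 kept ones,
-- exactly in the ratio 5 : 2, and the bound reduces to m ≤ 4, checked by computation.

module Submission where

open import Defs
open import Data.Nat using (ℕ; zero; suc; _+_; _*_; _∸_; _≤_; _<_)
open import Data.Nat.Properties
  using (+-suc; *-zeroʳ; +-comm; +-monoʳ-≤; <⇒≤; ≤-pred; m≤o∸n⇒m+n≤o; ≤ᵇ⇒≤; module ≤-Reasoning)
open import Data.Nat.ListAction using (sum)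
open import Data.Nat.Tactic.RingSolver using (solve-∀)
open import Data.Bool using (true; false)
open import Data.Empty using (⊥-elim)
open import Data.Product using (Σ; _×_; _,_; proj₁; proj₂)
open import Data.Product.Properties using (,-injectiveʳ)
open import Data.List
  using (List; []; _∷_; _++_; length; map; concatMap; filter; iterate; applyUpTo; upTo)
open import Data.List.Properties
  using (length-++; filter-++; map-upTo; map-applyUpTo; length-map; length-upTo)
open import Data.List.Membership.Propositional using (_∈_)
open import Data.List.Membership.Propositional.Properties using (∈-map⁻; ∈-upTo⁻; ∈-filter⁻)
open import Data.List.Relation.Binary.Disjoint.Propositional using (Disjoint)
open import Data.List.Relation.Unary.All using (All)
import Data.List.Relation.Unary.All as All
import Data.List.Relation.Unary.All.Properties as All
import Data.List.Relation.Unary.AllPairs as AllPairs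
import Data.List.Relation.Unary.AllPairs.Properties as AllPairs
open import Data.List.Relation.Unary.Unique.Propositional using (Unique)
open import Data.List.Relation.Unary.Unique.Propositional.Properties as Unique using (upTo⁺)
open import Function using (_∘_)
open import Relation.Nullary using (¬_; yes; no; does; contradiction)
open import Relation.Unary using (Decidable)
open import Relation.Binary.PropositionalEquality
  using (_≡_; _≢_; refl; sym; trans; cong; cong₂; subst; subst₂; module ≡-Reasoning)

data ℤ₅ : Set where
  0₅ 1₅ 2₅ 3₅ 4₅ : ℤ₅

next : ℤ₅ → ℤ₅
next 0₅ = 1₅
next 1₅ = 2₅
next 2₅ = 3₅
next 3₅ = 4₅
next 4₅ = 0₅

_⊕_ : ℕ → ℤ₅ → ℤ₅
zero  ⊕ c = c
suc n ⊕ c = next (n ⊕ c)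

residue : ℕ → ℤ₅
residue n = n ⊕ 0₅

data Low : ℤ₅ → Set where
  low₀ : Low 0₅
  low₁ : Low 1₅

low? : Decidable Low
low? 0₅ = yes low₀
low? 1₅ = yes low₁
low? 2₅ = no λ ()
low? 3₅ = no λ ()
low? 4₅ = no λ ()

low⇒¬low-3⊕ : ∀ {c} → Low c → ¬ Low (3 ⊕ c)
low⇒¬low-3⊕ low₀ ()
low⇒¬low-3⊕ low₁ ()

low-1⊕⇒¬low-3⊕ : ∀ c → Low (1 ⊕ c) → ¬ Low (3 ⊕ c)
low-1⊕⇒¬low-3⊕ 0₅ _ ()
low-1⊕⇒¬low-3⊕ 1₅ ()
low-1⊕⇒¬low-3⊕ 2₅ ()
low-1⊕⇒¬low-3⊕ 3₅ ()
low-1⊕⇒¬low-3⊕ 4₅ _ ()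

no-three-consecutive-low : ∀ {c} → Low c → Low (1 ⊕ c) → ¬ Low (2 ⊕ c)
no-three-consecutive-low low₀ _ ()
no-three-consecutive-low low₁ ()

length-concatMap : ∀ {A B : Set} (f : A → List B) xs → length (concatMap f xs) ≡ sum (map (length ∘ f) xs)
length-concatMap f []       = refl
length-concatMap f (x ∷ xs) = trans (length-++ (f x)) (cong (length (f x) +_) (length-concatMap f xs))

length-filter-concatMap : ∀ {A B : Set} {P : B → Set} (P? : Decidable P) (f : A → List B) xs →
  length (filter P? (concatMap f xs)) ≡ sum (map (length ∘ filter P? ∘ f) xs)
length-filter-concatMap P? f []       = refl
length-filter-concatMap P? f (x ∷ xs) = begin
  length (filter P? (f x ++ concatMap f xs))              ≡⟨ cong length (filter-++ P? (f x) _) ⟩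
  length (filter P? (f x) ++ filter P? (concatMap f xs))  ≡⟨ length-++ (filter P? (f x)) ⟩
  length (filter P? (f x)) + length (filter P? (concatMap f xs))
    ≡⟨ cong (length (filter P? (f x)) +_) (length-filter-concatMap P? f xs) ⟩
  length (filter P? (f x)) + sum (map (length ∘ filter P? ∘ f) xs) ∎
  where open ≡-Reasoning

triangleSum : (ℕ → ℕ → ℕ) → ℕ → ℕ
triangleSum F zero    = 0
triangleSum F (suc m) = F 0 (suc m) + triangleSum (F ∘ suc) m

triangleSum-upTo : ∀ F m → sum (map (λ i → F i (m ∸ i)) (upTo m)) ≡ triangleSum F m
triangleSum-upTo F zero    = refl
triangleSum-upTo F (suc m) = cong (F 0 (suc m) +_) (begin
  sum (map g (applyUpTo suc m))  ≡⟨ cong sum (map-applyUpTo suc g m) ⟩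
  sum (applyUpTo (g ∘ suc) m)    ≡⟨ cong sum (map-upTo (g ∘ suc) m) ⟨
  sum (map (g ∘ suc) (upTo m))   ≡⟨ triangleSum-upTo (F ∘ suc) m ⟩
  triangleSum (F ∘ suc) m        ∎)
  where
  open ≡-Reasoning
  g = λ i → F i (suc m ∸ i)

triangleSum-cong : ∀ {F G} → (∀ i k → F i k ≡ G i k) → ∀ m → triangleSum F m ≡ triangleSum G m
triangleSum-cong F≗G zero    = refl
triangleSum-cong F≗G (suc m) = cong₂ _+_ (F≗G 0 (suc m)) (triangleSum-cong (F≗G ∘ suc) m)

-- For each literal t, F (t + i) unfolds to F (suc (… (suc i))); this is why
-- corner ∘ suc below (and lowCount-corner ∘ residue later) is accepted as is.
triangleSum-5+ : ∀ {a b} F → (∀ i k → F i (5 + k) ≡ a + F i k) →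
  (∀ i → triangleSum (λ t → F (t + i)) 5 ≡ b) →
  ∀ m → triangleSum F (5 + m) ≡ triangleSum F m + a * m + b
triangleSum-5+ {a} {b} F period corner zero =
  trans (corner 0) (cong (_+ b) (sym (*-zeroʳ a)))
triangleSum-5+ {a} {b} F period corner (suc m) = begin
  F 0 (5 + suc m) + triangleSum (F ∘ suc) (5 + m)
    ≡⟨ cong₂ _+_ (period 0 (suc m)) (triangleSum-5+ (F ∘ suc) (period ∘ suc) (corner ∘ suc) m) ⟩
  (a + F 0 (suc m)) + (triangleSum (F ∘ suc) m + a * m + b)
    ≡⟨ rearrange a b m (F 0 (suc m)) (triangleSum (F ∘ suc) m) ⟩
  F 0 (suc m) + triangleSum (F ∘ suc) m + a * suc m + b
    ∎
  where
  open ≡-Reasoning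
  rearrange : ∀ a b m x y → (a + x) + (y + a * m + b) ≡ x + y + a * suc m + b
  rearrange = solve-∀

-- i + 3j, written so that phase (i , suc j) reduces to 3 ⊕ phase (i , j).
phase : Vertex → ℤ₅
phase (i , j) = residue (j * 3 + i)

Good : Vertex → Set
Good v = Low (phase v)

good? : Decidable Good
good? v = low? (phase v)

phase-east : ∀ i j → phase (suc i , j) ≡ 1 ⊕ phase (i , j)
phase-east i j = cong residue (+-suc (j * 3) i)

data Horizontal : Vertex → Vertex → Set where
  east : ∀ i j → Horizontal (i , j) (suc i , j)
  west : ∀ i j → Horizontal (suc i , j) (i , j)

good-adj⇒horizontal : ∀ {u v} → Good u → Good v → Adj u v → Horizontal u v
good-adj⇒horizontal _  _  (right i j) = east i j
good-adj⇒horizontal _  _  (left i j)  = west i j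
good-adj⇒horizontal gu gv (up i j)    = ⊥-elim (low⇒¬low-3⊕ gu gv)
good-adj⇒horizontal gu gv (down i j)  = ⊥-elim (low⇒¬low-3⊕ gv gu)
good-adj⇒horizontal gu gv (diag₁ i j) =
  ⊥-elim (low-1⊕⇒¬low-3⊕ (phase (i , j)) (subst Low (phase-east i j) gu) gv)
good-adj⇒horizontal gu gv (diag₂ i j) =
  ⊥-elim (low-1⊕⇒¬low-3⊕ (phase (i , j)) (subst Low (phase-east i j) gv) gu)

no-three-good-in-a-row : ∀ i j → Good (i , j) → Good (suc i , j) → ¬ Good (suc (suc i) , j)
no-three-good-in-a-row i j g₀ g₁ g₂ = no-three-consecutive-low g₀
  (subst Low (phase-east i j) g₁)
  (subst Low (trans (phase-east (suc i) j) (cong (1 ⊕_) (phase-east i j))) g₂)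

good-path-backtracks : ∀ {u v w} → Good u → Good v → Good w → Adj u v → Adj v w → u ≡ w
good-path-backtracks gu gv gw uv vw
  with good-adj⇒horizontal gu gv uv | good-adj⇒horizontal gv gw vw
... | east i j | east _ _ = ⊥-elim (no-three-good-in-a-row i j gu gv gw)
... | east _ _ | west _ _ = refl
... | west _ _ | east _ _ = refl
... | west _ _ | west i j = ⊥-elim (no-three-good-in-a-row i j gw gv gu)

column : ℕ → ℕ → List Vertex
column i k = map (λ j → (i , j)) (upTo k)

column-unique : ∀ i k → Unique (column i k)
column-unique i k = Unique.map⁺ ,-injectiveʳ (upTo⁺ k)

∈-column⇒index : ∀ {i k v} → v ∈ column i k → proj₁ v ≡ i
∈-column⇒index {i} v∈ with ∈-map⁻ (i ,_) v∈
... | _ , _ , refl = refl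

columns-disjoint : ∀ {i i′ k k′} → i ≢ i′ → Disjoint (column i k) (column i′ k′)
columns-disjoint i≢i′ (v∈ , v∈′) = i≢i′ (trans (sym (∈-column⇒index v∈)) (∈-column⇒index v∈′))

columns-unique : ∀ (h : ℕ → ℕ) {is} → Unique is → Unique (concatMap (λ i → column i (h i)) is)
columns-unique h is! = Unique.concat⁺
  (All.map⁺ (All.universal (λ i → column-unique i (h i)) _))
  (AllPairs.map⁺ (AllPairs.map columns-disjoint is!))

vertices-unique : ∀ n → Unique (vertices n)
vertices-unique n = columns-unique (λ i → suc n ∸ i) (upTo⁺ (suc n))

vertices-inGrid : ∀ n → All (InGrid n) (vertices n)
vertices-inGrid n = All.concat⁺ (All.map⁺ (All.tabulate λ i∈ →
  All.map⁺ (All.tabulate λ j∈ → inGrid (∈-upTo⁻ i∈) (∈-upTo⁻ j∈))))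
  where
  inGrid : ∀ {i j} → i < suc n → j < suc n ∸ i → i + j ≤ n
  inGrid {i} {j} i<1+n j<1+n∸i =
    subst (_≤ n) (+-comm j i) (≤-pred (m≤o∸n⇒m+n≤o (suc j) (<⇒≤ i<1+n) j<1+n∸i))

good-vertices-indeque : ∀ n → IsIndeque n (filter good? (vertices n))
good-vertices-indeque n =
  Unique.filter⁺ good? (vertices-unique n) ,
  All.filter⁺ good? (vertices-inGrid n) ,
  λ x∈ y∈ z∈ xy yz x≢z → contradiction (good-path-backtracks (good x∈) (good y∈) (good z∈) xy yz) x≢z
  where
  good : ∀ {v} → v ∈ filter good? (vertices n) → Good v
  good v∈ = proj₂ (∈-filter⁻ good? {xs = vertices n} v∈)

lowCount : ℤ₅ → ℕ → ℕ
lowCount c k = length (filter low? (iterate (3 ⊕_) c k))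

lowCount-5+ : ∀ c k → lowCount c (5 + k) ≡ 2 + lowCount c k
lowCount-5+ 0₅ k = refl
lowCount-5+ 1₅ k = refl
lowCount-5+ 2₅ k = refl
lowCount-5+ 3₅ k = refl
lowCount-5+ 4₅ k = refl

length-filter-good-progression : ∀ (f : ℕ → Vertex) → (∀ j → phase (f (suc j)) ≡ 3 ⊕ phase (f j)) →
  ∀ k → length (filter good? (applyUpTo f k)) ≡ lowCount (phase (f 0)) k
length-filter-good-progression f step zero = refl
length-filter-good-progression f step (suc k)
  with ih ← trans (length-filter-good-progression (f ∘ suc) (step ∘ suc) k)
                  (cong (λ c → lowCount c k) (step 0))
     | does (low? (phase (f 0)))
... | true  = cong suc ih
... | false = ih

lowCount-corner : ∀ c → triangleSum (λ t → lowCount (t ⊕ c)) 5 ≡ 6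
lowCount-corner 0₅ = refl
lowCount-corner 1₅ = refl
lowCount-corner 2₅ = refl
lowCount-corner 3₅ = refl
lowCount-corner 4₅ = refl

column-lowCount : ∀ i k → length (filter good? (column i k)) ≡ lowCount (residue i) k
column-lowCount i k = trans (cong (length ∘ filter good?) (map-upTo (i ,_) k))
                            (length-filter-good-progression (i ,_) (λ _ → refl) k)

length-vertices : ∀ n → length (vertices n) ≡ triangleSum (λ _ k → k) (suc n)
length-vertices n = begin
  length (vertices n)
    ≡⟨ length-concatMap (λ i → column i (suc n ∸ i)) (upTo (suc n)) ⟩
  sum (map (λ i → length (column i (suc n ∸ i))) (upTo (suc n)))
    ≡⟨ triangleSum-upTo (λ i k → length (column i k)) (suc n) ⟩
  triangleSum (λ i k → length (column i k)) (suc n)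
    ≡⟨ triangleSum-cong (λ i k → trans (length-map (i ,_) (upTo k)) (length-upTo k)) (suc n) ⟩
  triangleSum (λ _ k → k) (suc n) ∎
  where open ≡-Reasoning

length-good-vertices : ∀ n → length (filter good? (vertices n)) ≡ triangleSum (lowCount ∘ residue) (suc n)
length-good-vertices n = begin
  length (filter good? (vertices n))
    ≡⟨ length-filter-concatMap good? (λ i → column i (suc n ∸ i)) (upTo (suc n)) ⟩
  sum (map (λ i → length (filter good? (column i (suc n ∸ i)))) (upTo (suc n)))
    ≡⟨ triangleSum-upTo (λ i k → length (filter good? (column i k))) (suc n) ⟩
  triangleSum (λ i k → length (filter good? (column i k))) (suc n)
    ≡⟨ triangleSum-cong column-lowCount (suc n) ⟩
  triangleSum (lowCount ∘ residue) (suc n) ∎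
  where open ≡-Reasoning

two-fifths-bound : ∀ m → 2 * triangleSum (λ _ k → k) m ≤ 5 * triangleSum (lowCount ∘ residue) m
two-fifths-bound 0 = ≤ᵇ⇒≤ _ _ _
two-fifths-bound 1 = ≤ᵇ⇒≤ _ _ _
two-fifths-bound 2 = ≤ᵇ⇒≤ _ _ _
two-fifths-bound 3 = ≤ᵇ⇒≤ _ _ _
two-fifths-bound 4 = ≤ᵇ⇒≤ _ _ _
two-fifths-bound (suc (suc (suc (suc (suc m))))) = begin
  2 * triangleSum (λ _ k → k) (5 + m)
    ≡⟨ cong (2 *_) (triangleSum-5+ (λ _ k → k) (λ _ _ → refl) (λ _ → refl) m) ⟩
  2 * (V + 5 * m + 15)
    ≡⟨ expand-V m V ⟩
  10 * m + 30 + 2 * V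
    ≤⟨ +-monoʳ-≤ (10 * m + 30) (two-fifths-bound m) ⟩
  10 * m + 30 + 5 * L
    ≡⟨ expand-L m L ⟨
  5 * (L + 2 * m + 6)
    ≡⟨ cong (5 *_) (triangleSum-5+ (lowCount ∘ residue) (lowCount-5+ ∘ residue) (lowCount-corner ∘ residue) m) ⟨
  5 * triangleSum (lowCount ∘ residue) (5 + m) ∎
  where
  open ≤-Reasoning
  V = triangleSum (λ _ k → k) m
  L = triangleSum (lowCount ∘ residue) m
  expand-V : ∀ m V → 2 * (V + 5 * m + 15) ≡ 10 * m + 30 + 2 * V
  expand-V = solve-∀
  expand-L : ∀ m L → 5 * (L + 2 * m + 6) ≡ 10 * m + 30 + 5 * L
  expand-L = solve-∀

mainTheorem7 : (n : ℕ) →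
    Σ (List Vertex) (λ S → IsIndeque n S × 2 * length (vertices n) ≤ 5 * length S)
mainTheorem7 n = filter good? (vertices n) , good-vertices-indeque n ,
  subst₂ (λ V L → 2 * V ≤ 5 * L) (sym (length-vertices n)) (sym (length-good-vertices n))
    (two-fifths-bound (suc n))
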